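{- Let $a$ be a positive integer that is not a perfect cube, let $p$ be a prime with $p>a^2+2a$, and let $n=ap^3+1$. If there exists an integer $b$ such that $b^{n-1}\equiv 1\pmod n$ and $b^a\not\equiv 1\pmod n$, then $n$ is prime. -}

module Defs where

open import Data.Nat as ℕ using (ℕ)
open import Data.Integer as ℤ using (ℤ; +_)
open import Data.Integer.Divisibility as ℤD using ()
open import Data.Product using (∃)
open import Relation.Binary.PropositionalEquality using (_≡_)

IsPerfectCube : ℕ → Set
IsPerfectCube a = ∃ λ c → c ℕ.* c ℕ.* c ≡ a

_≡_[mod_] : ℤ → ℤ → ℕ → Set
x ≡ y [mod n ] = (+ n) ℤD.∣ (x ℤ.- y)

{-# OPTIONS --safe #-}
-- Let N = a p³ + 1 and c = bᵃ, so that c^(p³) ≡ 1 but c ≢ 1 (mod N). Since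
-- c^(p³) − 1 = (c − 1)(1 + c + ⋯ + c^(p³−1)), some prime q divides both N and the
-- geometric sum. Then c ≢ 1 (mod q): otherwise the sum is ≡ p³ (mod q), forcing q = p,
-- which does not divide N. So the order of c modulo q is a nontrivial power of p, and
-- Fermat's little theorem gives p ∣ q − 1. Writing q = x p + 1, the cofactor N / q is
-- ≡ 1 (mod p); if it is not 1 it is y p + 1, and (x p + 1)(y p + 1) = a p³ + 1 together
-- with a² + 2a < p forces a = x³.
module Submission where

open import Defs
open import Data.Nat
open import Data.Nat.Properties
open import Data.Nat.Divisibility
open import Data.Nat.Primality
  using (Prime; ¬prime[0]; euclidsLemma; prime⇒irreducible; prime⇒nonZero; prime⇒nonTrivial)
open import Data.Nat.Primality.Factorisation using (factorise)
open import Data.Nat.Coprimality using (Coprime; coprime?; coprime-divisor; coprime-Bézout; gcd≡1⇒coprime)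
open import Data.Nat.GCD using (gcd; gcd[m,n]∣m; gcd[m,n]∣n; gcd[m,n]≡0⇒m≡0; module Bézout)
open import Data.Nat.Combinatorics using (_C_; nCk≡n!/k![n-k]!; k![n∸k]!∣n!; nCn≡1)
open import Data.Nat.DivMod using (_/_; m/n*n≡m)
open import Data.Nat.ListAction using (product)
open import Data.Nat.Tactic.RingSolver using (solve-∀)
open import Data.Fin as Fin using (Fin; toℕ; inject₁; fromℕ)
open import Data.Fin.Properties using (toℕ-inject₁; toℕ-fromℕ; toℕ<n)
open import Data.Integer as ℤ using (ℤ; +_; 0ℤ; 1ℤ)
import Data.Integer.Properties as ℤP
import Data.Integer.Divisibility.Signed as ℤ∣
open import Data.Integer.DivMod using (_%ℕ_; _/ℕ_; a≡a%ℕn+[a/ℕn]*n)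
import Data.Integer.Tactic.RingSolver as ℤ-Solver
open import Data.List using ([]; _∷_)
open import Data.List.Relation.Unary.All using (_∷_)
open import Data.Product using (∃; _×_; _,_; proj₁; proj₂)
open import Data.Sum using (_⊎_; inj₁; inj₂)
open import Function using (_∘_)
open import Relation.Nullary using (¬_; contradiction; yes; no)
open import Relation.Binary using (Setoid; tri<; tri≈; tri>)
open import Relation.Binary.PropositionalEquality
import Relation.Binary.Reasoning.Setoid as ≈-Reasoning
open import Algebra.Bundles using (CommutativeSemiring)
import Algebra.Properties.CommutativeSemiring.Binomial as Binomial
import Algebra.Properties.Monoid.Sum as MonoidSum
import Algebra.Definitions.RawMonoid as RawMonoid
import Algebra.Definitions.RawSemiring as RawSemiring

-- Congruences of integers

-- Defs' congruence unfolds to a divisibility of absolute values, from which Agda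
-- cannot recover the two integers; this record is the same relation, but injective.
infix 4 _≈_[mod_]

record _≈_[mod_] (x y : ℤ) (n : ℕ) : Set where
  constructor mod
  field unmod : x ≡ y [mod n ]
open _≈_[mod_] public

module _ {n : ℕ} where

  private
    from-signed : ∀ {x y z} → z ≡ x ℤ.- y → + n ℤ∣.∣ z → x ≈ y [mod n ]
    from-signed eq n∣z = mod (ℤ∣.∣⇒∣ᵤ (subst (+ n ℤ∣.∣_) eq n∣z))

    signed : ∀ {x y} → x ≈ y [mod n ] → + n ℤ∣.∣ x ℤ.- y
    signed (mod n∣x-y) = ℤ∣.∣ᵤ⇒∣ n∣x-y

  mod-refl : ∀ {x} → x ≈ x [mod n ]
  mod-refl {x} = mod (subst (λ z → n ∣ ℤ.∣ z ∣) (sym (ℤP.+-inverseʳ x)) (n ∣0))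

  mod-reflexive : ∀ {x y} → x ≡ y → x ≈ y [mod n ]
  mod-reflexive refl = mod-refl

  mod-sym : ∀ {x y} → x ≈ y [mod n ] → y ≈ x [mod n ]
  mod-sym {x} {y} x≈y = from-signed (identity x y) (ℤ∣.∣m⇒∣-m (signed x≈y))
    where
    identity : ∀ x y → ℤ.- (x ℤ.- y) ≡ y ℤ.- x
    identity = ℤ-Solver.solve-∀

  mod-trans : ∀ {x y z} → x ≈ y [mod n ] → y ≈ z [mod n ] → x ≈ z [mod n ]
  mod-trans {x} {y} {z} x≈y y≈z =
    from-signed (identity x y z) (ℤ∣.∣m∣n⇒∣m+n (signed x≈y) (signed y≈z))
    where
    identity : ∀ x y z → (x ℤ.- y) ℤ.+ (y ℤ.- z) ≡ x ℤ.- z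
    identity = ℤ-Solver.solve-∀

  mod-+ : ∀ {x y u v} → x ≈ y [mod n ] → u ≈ v [mod n ] → x ℤ.+ u ≈ y ℤ.+ v [mod n ]
  mod-+ {x} {y} {u} {v} x≈y u≈v =
    from-signed (identity x y u v) (ℤ∣.∣m∣n⇒∣m+n (signed x≈y) (signed u≈v))
    where
    identity : ∀ x y u v → (x ℤ.- y) ℤ.+ (u ℤ.- v) ≡ (x ℤ.+ u) ℤ.- (y ℤ.+ v)
    identity = ℤ-Solver.solve-∀

  mod-* : ∀ {x y u v} → x ≈ y [mod n ] → u ≈ v [mod n ] → x ℤ.* u ≈ y ℤ.* v [mod n ]
  mod-* {x} {y} {u} {v} x≈y u≈v = from-signed (identity x y u v)
    (ℤ∣.∣m∣n⇒∣m+n (ℤ∣.∣n⇒∣m*n x (signed u≈v)) (ℤ∣.∣m⇒∣m*n v (signed x≈y)))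
    where
    identity : ∀ x y u v → x ℤ.* (u ℤ.- v) ℤ.+ (x ℤ.- y) ℤ.* v ≡ x ℤ.* u ℤ.- y ℤ.* v
    identity = ℤ-Solver.solve-∀

  mod-multiple : ∀ {x y} k → x ≡ y ℤ.+ k ℤ.* + n → x ≈ y [mod n ]
  mod-multiple {x} {y} k refl = from-signed (identity y (k ℤ.* + n)) (ℤ∣.divides k refl)
    where
    identity : ∀ y z → z ≡ (y ℤ.+ z) ℤ.- y
    identity = ℤ-Solver.solve-∀

  ∣⇒≈0 : ∀ {x} → n ∣ ℤ.∣ x ∣ → x ≈ 0ℤ [mod n ]
  ∣⇒≈0 {x} n∣x = mod (subst (λ z → n ∣ ℤ.∣ z ∣) (sym (ℤP.+-identityʳ x)) n∣x)

  ≈0⇒∣ : ∀ {x} → x ≈ 0ℤ [mod n ] → n ∣ ℤ.∣ x ∣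
  ≈0⇒∣ {x} (mod n∣x) = subst (λ z → n ∣ ℤ.∣ z ∣) (ℤP.+-identityʳ x) n∣x

  pos-+-multiple : ∀ a {d} → n ∣ d → + (a + d) ≈ + a [mod n ]
  pos-+-multiple a {d} n∣d = mod (subst (λ z → n ∣ ℤ.∣ z ∣) +d≡+[a+d]-+a n∣d)
    where
    identity : ∀ (a d : ℤ) → d ≡ (a ℤ.+ d) ℤ.- a
    identity = ℤ-Solver.solve-∀
    +d≡+[a+d]-+a : + d ≡ + (a + d) ℤ.- + a
    +d≡+[a+d]-+a = trans (identity (+ a) (+ d)) (cong (ℤ._- + a) (sym (ℤP.pos-+ a d)))

  mod-^ : ∀ {x y} k → x ≈ y [mod n ] → x ℤ.^ k ≈ y ℤ.^ k [mod n ]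
  mod-^ zero    _   = mod-refl
  mod-^ (suc k) x≈y = mod-* x≈y (mod-^ k x≈y)

mod-setoid : ℕ → Setoid _ _
mod-setoid n = record
  { Carrier       = ℤ
  ; _≈_           = _≈_[mod n ]
  ; isEquivalence = record { refl = mod-refl ; sym = mod-sym ; trans = mod-trans }
  }

mod-divisor : ∀ {d n x y} → d ∣ n → x ≈ y [mod n ] → x ≈ y [mod d ]
mod-divisor d∣n (mod n∣x-y) = mod (∣-trans d∣n n∣x-y)

-- Fermat's little theorem

prime⇒>1 : ∀ {p} → Prime p → p > 1
prime⇒>1 {p} pp = nonTrivial⇒n>1 p {{prime⇒nonTrivial pp}}

-- The binomial theorem is stated with the semiring's own power and multiple, which agree
-- with ℕ's _^_ and _*_ only propositionally.
private
  module BinomialTheorem = Binomial +-*-commutativeSemiring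
  open MonoidSum +-0-monoid using (sum; sum-init-last; sum-cong-≗)
  open RawMonoid (CommutativeSemiring.+-rawMonoid +-*-commutativeSemiring)
    using () renaming (_×_ to _×ᴹ_)
  open RawSemiring (CommutativeSemiring.rawSemiring +-*-commutativeSemiring)
    using () renaming (_^_ to _^ᴿ_)

  ^ᴿ≡^ : ∀ x n → x ^ᴿ n ≡ x ^ n
  ^ᴿ≡^ x zero    = refl
  ^ᴿ≡^ x (suc n) = cong (x *_) (^ᴿ≡^ x n)

  ×ᴹ≡* : ∀ n x → n ×ᴹ x ≡ n * x
  ×ᴹ≡* zero    x = refl
  ×ᴹ≡* (suc n) x = cong (λ y → x + y) (×ᴹ≡* n x)

∣-sum : ∀ {d n} (f : Fin n → ℕ) → (∀ i → d ∣ f i) → d ∣ sum f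
∣-sum {n = zero}  f _     = _ ∣0
∣-sum {n = suc n} f d∣f = ∣m∣n⇒∣m+n (d∣f Fin.zero) (∣-sum (f ∘ Fin.suc) (d∣f ∘ Fin.suc))

inner-binomial-term : ∀ n → ℕ → Fin n → ℕ
inner-binomial-term n x i = (suc n C suc (toℕ i)) * x ^ suc (toℕ i)

binomial-split : ∀ n x → (x + 1) ^ suc n ≡ 1 + sum (inner-binomial-term n x) + x ^ suc n
binomial-split n x = begin
  (x + 1) ^ suc n                                                       ≡⟨ sym (^ᴿ≡^ (x + 1) (suc n)) ⟩
  (x + 1) ^ᴿ suc n                                                      ≡⟨ BinomialTheorem.theorem (suc n) x 1 ⟩
  sum t                                                                 ≡⟨ sum-init-last t ⟩
  t Fin.zero + sum (λ i → t (inject₁ (Fin.suc i))) + t (fromℕ (suc n))  ≡⟨ cong₂ (λ u v → u + v + t (fromℕ (suc n))) first (sum-cong-≗ inner) ⟩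
  1 + sum (inner-binomial-term n x) + t (fromℕ (suc n))                 ≡⟨ cong (λ y → 1 + sum (inner-binomial-term n x) + y) last ⟩
  1 + sum (inner-binomial-term n x) + x ^ suc n                         ∎
  where
  open ≡-Reasoning
  t : Fin (suc (suc n)) → ℕ
  t = BinomialTheorem.binomialTerm x 1 (suc n)
  term : ∀ k → (suc n C k) ×ᴹ (x ^ᴿ k * 1 ^ᴿ (suc n ∸ k)) ≡ (suc n C k) * x ^ k
  term k = begin
    (suc n C k) ×ᴹ (x ^ᴿ k * 1 ^ᴿ (suc n ∸ k))  ≡⟨ ×ᴹ≡* (suc n C k) _ ⟩
    (suc n C k) * (x ^ᴿ k * 1 ^ᴿ (suc n ∸ k))   ≡⟨ cong₂ (λ u v → (suc n C k) * (u * v)) (^ᴿ≡^ x k) 1^ᴿ≡1 ⟩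
    (suc n C k) * (x ^ k * 1)                   ≡⟨ cong ((suc n C k) *_) (*-identityʳ _) ⟩
    (suc n C k) * x ^ k                         ∎
    where
    1^ᴿ≡1 : 1 ^ᴿ (suc n ∸ k) ≡ 1
    1^ᴿ≡1 = trans (^ᴿ≡^ 1 (suc n ∸ k)) (^-zeroˡ (suc n ∸ k))
  first : t Fin.zero ≡ 1
  first = trans (term 0) (+-identityʳ 1)
  inner : ∀ i → t (inject₁ (Fin.suc i)) ≡ inner-binomial-term n x i
  inner i = trans (term (toℕ (inject₁ (Fin.suc i)))) (cong (λ k → (suc n C suc k) * x ^ suc k) (toℕ-inject₁ i))
  last : t (fromℕ (suc n)) ≡ x ^ suc n
  last = begin
    t (fromℕ (suc n))             ≡⟨ trans (term (toℕ (fromℕ (suc n)))) (cong (λ k → (suc n C k) * x ^ k) (toℕ-fromℕ (suc n))) ⟩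
    (suc n C suc n) * x ^ suc n   ≡⟨ cong (_* x ^ suc n) (nCn≡1 (suc n)) ⟩
    1 * x ^ suc n                 ≡⟨ *-identityˡ _ ⟩
    x ^ suc n                     ∎

n∣n! : ∀ n .{{_ : NonZero n}} → n ∣ n !
n∣n! (suc n) = m∣m*n (n !)

pos-^ : ∀ m k → (+ m) ℤ.^ k ≡ + (m ^ k)
pos-^ m zero    = refl
pos-^ m (suc k) = trans (cong (+ m ℤ.*_) (pos-^ m k)) (sym (ℤP.pos-* m (m ^ k)))

module _ {p} (pp : Prime p) where

  private instance
    p≢0 : NonZero p
    p≢0 = prime⇒nonZero pp

  prime∤! : ∀ {k} → k < p → ¬ p ∣ k !
  prime∤! {zero}  _   p∣1  = <⇒≢ (prime⇒>1 pp) (sym (∣1⇒≡1 p∣1))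
  prime∤! {suc k} k<p p∣k! with euclidsLemma (suc k) (k !) pp p∣k!
  ... | inj₁ p∣k+1 = <⇒≱ k<p (∣⇒≤ p∣k+1)
  ... | inj₂ p∣k!′ = prime∤! (<⇒≤ k<p) p∣k!′

  prime∣C : ∀ {k} → 0 < k → k < p → p ∣ p C k
  prime∣C {k} 0<k k<p with euclidsLemma (p C k) (k ! * (p ∸ k) !) pp p∣C*k![p∸k]!
    where
    instance _ = k !* (p ∸ k) !≢0
    p∣C*k![p∸k]! : p ∣ (p C k) * (k ! * (p ∸ k) !)
    p∣C*k![p∸k]! = subst (p ∣_) (sym (begin
      (p C k) * (k ! * (p ∸ k) !)                 ≡⟨ cong (_* (k ! * (p ∸ k) !)) (nCk≡n!/k![n-k]! (<⇒≤ k<p)) ⟩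
      (p ! / (k ! * (p ∸ k) !)) * (k ! * (p ∸ k) !) ≡⟨ m/n*n≡m (k![n∸k]!∣n! (<⇒≤ k<p)) ⟩
      p !                                          ∎)) (n∣n! p)
      where open ≡-Reasoning
  ... | inj₁ p∣C = p∣C
  ... | inj₂ p∣k!*[p∸k]! with euclidsLemma (k !) ((p ∸ k) !) pp p∣k!*[p∸k]!
  ...   | inj₁ p∣k! = contradiction p∣k! (prime∤! k<p)
  ...   | inj₂ p∣[p∸k]! = contradiction p∣[p∸k]! (prime∤! (∸-monoʳ-< 0<k (<⇒≤ k<p)))

freshmans-dream : ∀ {n} → Prime (suc n) → ∀ x → + ((x + 1) ^ suc n) ≈ + (x ^ suc n + 1) [mod suc n ]
freshmans-dream {n} pp x = begin
  + ((x + 1) ^ suc n)                                ≡⟨ cong +_ (trans (binomial-split n x) (reorder 1 (sum (inner-binomial-term n x)) (x ^ suc n))) ⟩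
  + (x ^ suc n + 1 + sum (inner-binomial-term n x))  ≈⟨ pos-+-multiple _ (∣-sum _ inner-divisible) ⟩
  + (x ^ suc n + 1)                                  ∎
  where
  open ≈-Reasoning (mod-setoid (suc n))
  reorder : ∀ a b c → a + b + c ≡ c + a + b
  reorder = solve-∀
  inner-divisible : ∀ i → suc n ∣ inner-binomial-term n x i
  inner-divisible i = ∣m⇒∣m*n _ (prime∣C pp z<s (s≤s (toℕ<n i)))

fermat-ℕ : ∀ {n} → Prime (suc n) → ∀ x → + (x ^ suc n) ≈ + x [mod suc n ]
fermat-ℕ {n} pp zero    = mod-refl
fermat-ℕ {n} pp (suc x) = begin
  + (suc x ^ suc n)          ≡⟨ cong (λ y → + (y ^ suc n)) (+-comm 1 x) ⟩
  + ((x + 1) ^ suc n)        ≈⟨ freshmans-dream pp x ⟩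
  + (x ^ suc n + 1)          ≡⟨ ℤP.pos-+ (x ^ suc n) 1 ⟩
  + (x ^ suc n) ℤ.+ 1ℤ       ≈⟨ mod-+ (fermat-ℕ pp x) (mod-refl {x = 1ℤ}) ⟩
  + x ℤ.+ 1ℤ                 ≡⟨ sym (ℤP.pos-+ x 1) ⟩
  + (x + 1)                  ≡⟨ cong +_ (+-comm x 1) ⟩
  + suc x                    ∎
  where open ≈-Reasoning (mod-setoid (suc n))

fermat : ∀ {p} → Prime p → ∀ c → c ℤ.^ p ≈ c [mod p ]
fermat {zero}  pp = contradiction pp ¬prime[0]
fermat {suc n} pp c = begin
  c ℤ.^ suc n        ≈⟨ mod-^ (suc n) c≈r ⟩
  (+ r) ℤ.^ suc n    ≡⟨ pos-^ r (suc n) ⟩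
  + (r ^ suc n)      ≈⟨ fermat-ℕ pp r ⟩
  + r                ≈⟨ mod-sym c≈r ⟩
  c                  ∎
  where
  open ≈-Reasoning (mod-setoid (suc n))
  r = c %ℕ suc n
  c≈r : c ≈ + r [mod suc n ]
  c≈r = mod-multiple (c /ℕ suc n) (a≡a%ℕn+[a/ℕn]*n c (suc n))

-- Multiplicative orders

module _ {n : ℕ} where
  open ≈-Reasoning (mod-setoid n)

  ^-multiple-≈1 : ∀ {c m} k → c ℤ.^ m ≈ 1ℤ [mod n ] → c ℤ.^ (k * m) ≈ 1ℤ [mod n ]
  ^-multiple-≈1 {c} {m} k c^m≈1 = begin
    c ℤ.^ (k * m)    ≡⟨ cong (c ℤ.^_) (*-comm k m) ⟩
    c ℤ.^ (m * k)    ≡⟨ sym (ℤP.^-*-assoc c m k) ⟩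
    (c ℤ.^ m) ℤ.^ k  ≈⟨ mod-^ k c^m≈1 ⟩
    1ℤ ℤ.^ k         ≡⟨ ℤP.^-zeroˡ k ⟩
    1ℤ               ∎

  private
    ≈1-from-Bézout : ∀ {c} m k x y → 1 + y * k ≡ x * m →
                     c ℤ.^ m ≈ 1ℤ [mod n ] → c ℤ.^ k ≈ 1ℤ [mod n ] → c ≈ 1ℤ [mod n ]
    ≈1-from-Bézout {c} m k x y eq c^m≈1 c^k≈1 = begin
      c                       ≡⟨ sym (ℤP.*-identityʳ c) ⟩
      c ℤ.* 1ℤ                ≈⟨ mod-* (mod-refl {x = c}) (mod-sym (^-multiple-≈1 y c^k≈1)) ⟩
      c ℤ.^ (1 + y * k)       ≡⟨ cong (c ℤ.^_) eq ⟩
      c ℤ.^ (x * m)           ≈⟨ ^-multiple-≈1 x c^m≈1 ⟩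
      1ℤ                      ∎

  coprime-exponents-≈1 : ∀ {c m k} → Coprime m k →
                         c ℤ.^ m ≈ 1ℤ [mod n ] → c ℤ.^ k ≈ 1ℤ [mod n ] → c ≈ 1ℤ [mod n ]
  coprime-exponents-≈1 {m = m} {k} m⊥k c^m≈1 c^k≈1 with coprime-Bézout m⊥k
  ... | Bézout.+- x y eq = ≈1-from-Bézout m k x y eq c^m≈1 c^k≈1
  ... | Bézout.-+ x y eq = ≈1-from-Bézout k m y x eq c^k≈1 c^m≈1

  ≉0-if-power-≈1 : ∀ {c m} → n ≢ 1 → 0 < m → c ℤ.^ m ≈ 1ℤ [mod n ] → ¬ c ≈ 0ℤ [mod n ]
  ≉0-if-power-≈1 {c} {suc m} n≢1 _ c^m≈1 c≈0 = n≢1 (∣1⇒≡1 (≈0⇒∣ (begin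
    1ℤ            ≈⟨ mod-sym c^m≈1 ⟩
    c ℤ.^ suc m   ≈⟨ mod-^ (suc m) c≈0 ⟩
    0ℤ            ∎)))

module _ {q} (qq : Prime q) where

  prime-mod-cancelˡ : ∀ {c x y} → ¬ c ≈ 0ℤ [mod q ] → c ℤ.* x ≈ c ℤ.* y [mod q ] → x ≈ y [mod q ]
  prime-mod-cancelˡ {c} {x} {y} c≉0 (mod q∣cx-cy)
    with euclidsLemma ℤ.∣ c ∣ ℤ.∣ x ℤ.- y ∣ qq q∣c*∣x-y∣
    where
    factor : ∀ c x y → c ℤ.* x ℤ.- c ℤ.* y ≡ c ℤ.* (x ℤ.- y)
    factor = ℤ-Solver.solve-∀
    q∣c*∣x-y∣ : q ∣ ℤ.∣ c ∣ * ℤ.∣ x ℤ.- y ∣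
    q∣c*∣x-y∣ = subst (q ∣_) (trans (cong ℤ.∣_∣ (factor c x y)) (ℤP.abs-* c (x ℤ.- y))) q∣cx-cy
  ... | inj₁ q∣c   = contradiction (∣⇒≈0 q∣c) c≉0
  ... | inj₂ q∣x-y = mod q∣x-y

  fermat-unit : ∀ {c} → ¬ c ≈ 0ℤ [mod q ] → c ℤ.^ (q ∸ 1) ≈ 1ℤ [mod q ]
  fermat-unit {c} c≉0 = prime-mod-cancelˡ c≉0 (begin
    c ℤ.* c ℤ.^ (q ∸ 1)   ≡⟨ cong (c ℤ.^_) (m+[n∸m]≡n (<⇒≤ (prime⇒>1 qq))) ⟩
    c ℤ.^ q               ≈⟨ fermat qq c ⟩
    c                     ≡⟨ sym (ℤP.*-identityʳ c) ⟩
    c ℤ.* 1ℤ              ∎)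
    where open ≈-Reasoning (mod-setoid q)

module _ {p} (pp : Prime p) where

  prime∤⇒coprime : ∀ {r} → ¬ p ∣ r → Coprime p r
  prime∤⇒coprime p∤r (i∣p , i∣r) with prime⇒irreducible pp i∣p
  ... | inj₁ i≡1 = i≡1
  ... | inj₂ refl = contradiction i∣r p∤r

  ≈1-from-prime-power-exponent : ∀ {n c r} j → ¬ p ∣ r →
    c ℤ.^ r ≈ 1ℤ [mod n ] → c ℤ.^ (p ^ j) ≈ 1ℤ [mod n ] → c ≈ 1ℤ [mod n ]
  ≈1-from-prime-power-exponent {c = c} zero _ _ c¹≈1 = mod-trans (mod-reflexive (sym (ℤP.^-identityʳ c))) c¹≈1
  ≈1-from-prime-power-exponent {n} {c} {r} (suc j) p∤r c^r≈1 c^p^[j+1]≈1 =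
    ≈1-from-prime-power-exponent j p∤r c^r≈1
      (coprime-exponents-≈1 (prime∤⇒coprime p∤r) e^p≈1 e^r≈1)
    where
    open ≈-Reasoning (mod-setoid n)
    e = c ℤ.^ (p ^ j)
    e^p≈1 : e ℤ.^ p ≈ 1ℤ [mod n ]
    e^p≈1 = begin
      e ℤ.^ p             ≡⟨ ℤP.^-*-assoc c (p ^ j) p ⟩
      c ℤ.^ (p ^ j * p)   ≡⟨ cong (c ℤ.^_) (*-comm (p ^ j) p) ⟩
      c ℤ.^ (p ^ suc j)   ≈⟨ c^p^[j+1]≈1 ⟩
      1ℤ                  ∎
    e^r≈1 : e ℤ.^ r ≈ 1ℤ [mod n ]
    e^r≈1 = begin
      e ℤ.^ r             ≡⟨ ℤP.^-*-assoc c (p ^ j) r ⟩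
      c ℤ.^ (p ^ j * r)   ≈⟨ ^-multiple-≈1 (p ^ j) c^r≈1 ⟩
      1ℤ                  ∎

  prime∣q∸1 : ∀ {q c} j → Prime q → c ℤ.^ (p ^ j) ≈ 1ℤ [mod q ] → ¬ c ≈ 1ℤ [mod q ] → p ∣ q ∸ 1
  prime∣q∸1 {q} {c} j qq c^p^j≈1 c≉1 with p ∣? q ∸ 1
  ... | yes p∣q∸1 = p∣q∸1
  ... | no  p∤q∸1 = contradiction
          (≈1-from-prime-power-exponent j p∤q∸1 (fermat-unit qq c≉0) c^p^j≈1) c≉1
    where
    instance _ = prime⇒nonZero pp
    c≉0 : ¬ c ≈ 0ℤ [mod q ]
    c≉0 = ≉0-if-power-≈1 (>⇒≢ (prime⇒>1 qq)) (m^n>0 p j) c^p^j≈1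

-- Factorisations (x p + 1)(y p + 1) = a p³ + 1

m+n≤m*n+1 : ∀ {m n} → 1 ≤ m → 1 ≤ n → m + n ≤ m * n + 1
m+n≤m*n+1 {suc m} {suc n} _ _ = ≤-trans (m≤m+n (suc m + suc n) (m * n)) (≤-reflexive (identity m n))
  where
  identity : ∀ m n → suc m + suc n + m * n ≡ suc m * suc n + 1
  identity = solve-∀

-- j (a+1)² − (a+j)² = (j−1)(a² − j), rearranged so that no subtraction occurs.
[a+j]²≤j[a+1]² : ∀ a i → suc i ≤ a * a → (a + suc i) * (a + suc i) ≤ suc i * ((a + 1) * (a + 1))
[a+j]²≤j[a+1]² a i j≤a² = +-cancelʳ-≤ (i * (a * a)) _ _ (begin
  (a + suc i) * (a + suc i) + i * (a * a)    ≡⟨ identity a i ⟩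
  suc i * ((a + 1) * (a + 1)) + i * suc i    ≤⟨ +-monoʳ-≤ (suc i * ((a + 1) * (a + 1))) (*-monoʳ-≤ i j≤a²) ⟩
  suc i * ((a + 1) * (a + 1)) + i * (a * a)  ∎)
  where
  open ≤-Reasoning
  identity : ∀ a i → (a + suc i) * (a + suc i) + i * (a * a) ≡ suc i * ((a + 1) * (a + 1)) + i * suc i
  identity = solve-∀

sum-and-product : ∀ {a p x y} .{{_ : NonZero p}} → (x * p + 1) * (y * p + 1) ≡ a * p ^ 3 + 1 →
                  ∃ λ s → x + y ≡ s * p × x * y + s ≡ a * p
sum-and-product {a} {p} {x} {y} eq = s , x+y≡sp , *-cancelʳ-≡ _ _ p (begin
    (x * y + s) * p             ≡⟨ *-distribʳ-+ p (x * y) s ⟩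
    x * y * p + s * p           ≡⟨ cong (λ z → x * y * p + z) (sym x+y≡sp) ⟩
    x * y * p + (x + y)         ≡⟨ divided ⟩
    a * p * p                   ∎)
  where
  open ≡-Reasoning
  expand : ∀ x y p → (x * p + 1) * (y * p + 1) ≡ p * (x * y * p + (x + y)) + 1
  expand = solve-∀
  expand-cube : ∀ a p → a * (p * (p * (p * 1))) + 1 ≡ p * (a * p * p) + 1
  expand-cube = solve-∀
  divided : x * y * p + (x + y) ≡ a * p * p
  divided = *-cancelˡ-≡ _ _ p (+-cancelʳ-≡ 1 _ _ (trans (sym (expand x y p)) (trans eq (expand-cube a p))))
  p∣x+y : p ∣ x + y
  p∣x+y = ∣m+n∣m⇒∣n (subst (p ∣_) (sym divided) (n∣m*n (a * p))) (n∣m*n (x * y))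
  open _∣_ p∣x+y renaming (quotient to s; equality to x+y≡sp)

-- Compare x s with a in x² + a p = x s p + s: equality gives x² = s, hence a = x³;
-- x s < a forces p ≤ s ≤ a < p; and x s = a + j with j ≥ 1 gives
-- x² = j p + s > j (a + 1)² ≥ (a + j)² ≥ x², as j < a and x ≤ x s.
module _ {a p x y s} (bound : a * a + 2 * a < p) (1≤x : 1 ≤ x) (x≤y : x ≤ y)
         (x+y≡sp : x + y ≡ s * p) (xy+s≡ap : x * y + s ≡ a * p) where

  private
    instance
      p≢0 : NonZero p
      p≢0 = >-nonZero (≤-<-trans z≤n bound)

    x²+ap≡xsp+s : x * x + a * p ≡ x * s * p + s
    x²+ap≡xsp+s = begin
      x * x + a * p          ≡⟨ cong (λ z → x * x + z) (sym xy+s≡ap) ⟩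
      x * x + (x * y + s)    ≡⟨ regroup x y s ⟩
      x * (x + y) + s        ≡⟨ cong (λ z → x * z + s) x+y≡sp ⟩
      x * (s * p) + s        ≡⟨ cong (_+ s) (sym (*-assoc x s p)) ⟩
      x * s * p + s          ∎
      where
      open ≡-Reasoning
      regroup : ∀ x y s → x * x + (x * y + s) ≡ x * (x + y) + s
      regroup = solve-∀

    1≤s : 1 ≤ s
    1≤s = n≢0⇒n>0 λ { refl → <⇒≱ (≤-trans 1≤x (m≤m+n x y)) (≤-reflexive x+y≡sp) }

    s≤a : s ≤ a
    s≤a = *-cancelʳ-≤ s a p (begin
      s * p         ≡⟨ sym x+y≡sp ⟩
      x + y         ≤⟨ m+n≤m*n+1 1≤x (≤-trans 1≤x x≤y) ⟩
      x * y + 1     ≤⟨ +-monoʳ-≤ (x * y) 1≤s ⟩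
      x * y + s     ≡⟨ xy+s≡ap ⟩
      a * p         ∎)
      where open ≤-Reasoning

    a<p : a < p
    a<p = ≤-<-trans (≤-trans (m≤m+n a (a + 0)) (m≤n+m (2 * a) (a * a))) bound

    xs≡a⇒cube : x * s ≡ a → x * x * x ≡ a
    xs≡a⇒cube xs≡a = begin
      x * x * x   ≡⟨ cong (_* x) x²≡s ⟩
      s * x       ≡⟨ *-comm s x ⟩
      x * s       ≡⟨ xs≡a ⟩
      a           ∎
      where
      open ≡-Reasoning
      x²≡s : x * x ≡ s
      x²≡s = +-cancelʳ-≡ (a * p) (x * x) s (begin
        x * x + a * p   ≡⟨ x²+ap≡xsp+s ⟩
        x * s * p + s   ≡⟨ cong (λ z → z * p + s) xs≡a ⟩
        a * p + s       ≡⟨ +-comm (a * p) s ⟩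
        s + a * p       ∎)

    xs≮a : ¬ x * s < a
    xs≮a xs<a = <-irrefl refl (≤-<-trans (≤-trans p≤s s≤a) a<p)
      where
      open ≤-Reasoning
      p≤s : p ≤ s
      p≤s = +-cancelʳ-≤ (x * s * p) p s (begin
        p + x * s * p     ≤⟨ *-monoˡ-≤ p xs<a ⟩
        a * p             ≤⟨ m≤n+m (a * p) (x * x) ⟩
        x * x + a * p     ≡⟨ x²+ap≡xsp+s ⟩
        x * s * p + s     ≡⟨ +-comm (x * s * p) s ⟩
        s + x * s * p     ∎)

    xs≯a : ¬ a < x * s
    xs≯a a<xs = <-irrefl refl (begin-strict
        x * x                          ≤⟨ *-mono-≤ x≤a+j x≤a+j ⟩
        (a + j) * (a + j)              ≤⟨ [a+j]²≤j[a+1]² a i j≤a² ⟩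
        j * ((a + 1) * (a + 1))        ≤⟨ *-monoʳ-≤ j [a+1]²≤p ⟩
        j * p                          <⟨ m<m+n (j * p) 1≤s ⟩
        j * p + s                      ≡⟨ sym x²≡jp+s ⟩
        x * x                          ∎)
      where
      open ≤-Reasoning
      i = proj₁ (m≤n⇒∃[o]m+o≡n a<xs)
      j = suc i
      a+j≡xs : a + j ≡ x * s
      a+j≡xs = trans (+-suc a i) (proj₂ (m≤n⇒∃[o]m+o≡n a<xs))
      x²≡jp+s : x * x ≡ j * p + s
      x²≡jp+s = +-cancelˡ-≡ (a * p) (x * x) (j * p + s) (begin-equality
        a * p + x * x        ≡⟨ +-comm (a * p) (x * x) ⟩
        x * x + a * p        ≡⟨ x²+ap≡xsp+s ⟩
        x * s * p + s        ≡⟨ cong (λ z → z * p + s) (sym a+j≡xs) ⟩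
        (a + j) * p + s      ≡⟨ cong (_+ s) (*-distribʳ-+ p a j) ⟩
        a * p + j * p + s    ≡⟨ +-assoc (a * p) (j * p) s ⟩
        a * p + (j * p + s)  ∎)
      j<a : j < a
      j<a = *-cancelʳ-< p j a (begin-strict
        j * p         <⟨ m<m+n (j * p) 1≤s ⟩
        j * p + s     ≡⟨ sym x²≡jp+s ⟩
        x * x         ≤⟨ *-monoʳ-≤ x x≤y ⟩
        x * y         ≤⟨ m≤m+n (x * y) s ⟩
        x * y + s     ≡⟨ xy+s≡ap ⟩
        a * p         ∎)
      j≤a² : j ≤ a * a
      j≤a² = ≤-trans (<⇒≤ j<a) (m≤m*n a a {{>-nonZero (≤-<-trans z≤n j<a)}})
      x≤a+j : x ≤ a + j
      x≤a+j = ≤-trans (m≤m*n x s {{>-nonZero 1≤s}}) (≤-reflexive (sym a+j≡xs))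
      [a+1]²≤p : (a + 1) * (a + 1) ≤ p
      [a+1]²≤p = ≤-trans (≤-reflexive (square a)) bound
        where
        square : ∀ a → (a + 1) * (a + 1) ≡ suc (a * a + 2 * a)
        square = solve-∀

  sum-and-product⇒cube : x * x * x ≡ a
  sum-and-product⇒cube with <-cmp (x * s) a
  ... | tri< xs<a _ _ = contradiction xs<a xs≮a
  ... | tri≈ _ xs≡a _ = xs≡a⇒cube xs≡a
  ... | tri> _ _ a<xs = contradiction a<xs xs≯a

factorisation⇒cube : ∀ {a p x y} → a * a + 2 * a < p →
                     (suc x * p + 1) * (suc y * p + 1) ≡ a * p ^ 3 + 1 → IsPerfectCube a
factorisation⇒cube {a} {p} {x} {y} bound eq =
  cube (sum-and-product {a} {p} {suc x} {suc y} {{>-nonZero (≤-<-trans z≤n bound)}} eq) (≤-total (suc x) (suc y))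
  where
  cube : (∃ λ s → suc x + suc y ≡ s * p × suc x * suc y + s ≡ a * p) →
         suc x ≤ suc y ⊎ suc y ≤ suc x → IsPerfectCube a
  cube (s , x+y≡sp , xy+s≡ap) (inj₁ x≤y) = suc x , sum-and-product⇒cube bound z<s x≤y x+y≡sp xy+s≡ap
  cube (s , x+y≡sp , xy+s≡ap) (inj₂ y≤x) = suc y , sum-and-product⇒cube bound z<s y≤x
    (trans (+-comm (suc y) (suc x)) x+y≡sp) (trans (cong (_+ s) (*-comm (suc y) (suc x))) xy+s≡ap)

-- Prime factors of a p³ + 1

prime-factor : ∀ {n} → 1 < n → ∃ λ q → Prime q × q ∣ n
prime-factor {n} 1<n with factorise n {{>-nonZero (<⇒≤ 1<n)}}
... | record { factors = [] ; isFactorisation = n≡1 } = contradiction n≡1 (>⇒≢ 1<n)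
... | record { factors = q ∷ qs ; isFactorisation = n≡q*qs ; factorsPrime = qq ∷ _ } =
  q , qq , subst (q ∣_) (sym n≡q*qs) (m∣m*n (product qs))

common-prime-factor : ∀ {m n} → m ≢ 0 → ¬ Coprime m n → ∃ λ q → Prime q × q ∣ m × q ∣ n
common-prime-factor {m} {n} m≢0 ¬m⊥n with prime-factor 1<gcd
  where
  1<gcd : 1 < gcd m n
  1<gcd with gcd m n in eq
  ... | zero        = contradiction (gcd[m,n]≡0⇒m≡0 eq) m≢0
  ... | suc zero    = contradiction (λ {d} → gcd≡1⇒coprime eq {d}) ¬m⊥n
  ... | suc (suc _) = s<s z<s
... | q , qq , q∣gcd = q , qq , ∣-trans q∣gcd (gcd[m,n]∣m m n) , ∣-trans q∣gcd (gcd[m,n]∣n m n)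

prime-dividing-power : ∀ {p q} k → Prime q → Prime p → q ∣ p ^ k → q ≡ p
prime-dividing-power zero    qq pp q∣1 = contradiction (∣1⇒≡1 q∣1) (>⇒≢ (prime⇒>1 qq))
prime-dividing-power {p} (suc k) qq pp q∣p^k+1 with euclidsLemma p (p ^ k) qq q∣p^k+1
... | inj₂ q∣p^k = prime-dividing-power k qq pp q∣p^k
... | inj₁ q∣p with prime⇒irreducible pp q∣p
...   | inj₁ q≡1 = contradiction q≡1 (>⇒≢ (prime⇒>1 qq))
...   | inj₂ q≡p = q≡p

positive-multiple : ∀ {p n} → 0 < n → p ∣ n → ∃ λ k → n ≡ suc k * p
positive-multiple {n = suc _} _ (divides zero    ())
positive-multiple {n = suc _} _ (divides (suc k) n≡[k+1]p) = k , n≡[k+1]p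

prime∤ap^k+1 : ∀ {p} a k → Prime p → ¬ p ∣ a * p ^ suc k + 1
prime∤ap^k+1 {p} a k pp p∣ap^k+1 = contradiction (∣1⇒≡1 p∣1) (>⇒≢ (prime⇒>1 pp))
  where
  p∣1 : p ∣ 1
  p∣1 = ∣m+n∣m⇒∣n p∣ap^k+1 (∣n⇒∣m*n a (m∣m*n (p ^ k)))

cofactor-≡1 : ∀ {a p x m} → m * (suc x * p + 1) ≡ a * p ^ 3 + 1 → m ≡ 1 ⊎ ∃ λ y → m ≡ suc y * p + 1
cofactor-≡1 {a} {p} {m = zero} eq = contradiction (trans eq (+-comm (a * p ^ 3) 1)) λ ()
cofactor-≡1 {m = suc zero} _ = inj₁ refl
cofactor-≡1 {a} {p} {x} {suc (suc m)} eq = inj₂ (as-[y+1]p+1 (positive-multiple z<s p∣m+1))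
  where
  expand : ∀ m x p → suc (suc m) * (suc x * p + 1) ≡ suc (suc m) * suc x * p + suc m + 1
  expand = solve-∀
  ap³≡ : a * p ^ 3 ≡ suc (suc m) * suc x * p + suc m
  ap³≡ = +-cancelʳ-≡ 1 _ _ (trans (sym eq) (expand m x p))
  p∣m+1 : p ∣ suc m
  p∣m+1 = ∣m+n∣m⇒∣n (subst (p ∣_) ap³≡ (∣n⇒∣m*n a (m∣m*n (p ^ 2)))) (n∣m*n (suc (suc m) * suc x))
  as-[y+1]p+1 : (∃ λ y → suc m ≡ suc y * p) → ∃ λ y → suc (suc m) ≡ suc y * p + 1
  as-[y+1]p+1 (y , m+1≡[y+1]p) = y , trans (+-comm 1 (suc m)) (cong (_+ 1) m+1≡[y+1]p)

prime-if-factor-of-form : ∀ {a p q x} → a * a + 2 * a < p → ¬ IsPerfectCube a →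
  Prime q → q ∣ a * p ^ 3 + 1 → q ≡ suc x * p + 1 → Prime (a * p ^ 3 + 1)
prime-if-factor-of-form {a} {p} {x = x} bound non-cube qq (divides m N≡mq) refl
  with cofactor-≡1 {a} {p} {x} {m} (sym N≡mq)
... | inj₁ refl = subst Prime (sym (trans N≡mq (*-identityˡ _))) qq
... | inj₂ (y , refl) =
  contradiction (factorisation⇒cube {a} {p} {x} {y} bound (trans (*-comm (suc x * p + 1) _) (sym N≡mq))) non-cube

prime-if-factor-≡1 : ∀ {a p q} → a * a + 2 * a < p → ¬ IsPerfectCube a →
  Prime q → q ∣ a * p ^ 3 + 1 → p ∣ q ∸ 1 → Prime (a * p ^ 3 + 1)
prime-if-factor-≡1 bound non-cube qq q∣N p∣q∸1
  with x , q∸1≡[x+1]p ← positive-multiple (m<n⇒0<n∸m (prime⇒>1 qq)) p∣q∸1 =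
  prime-if-factor-of-form {x = x} bound non-cube qq q∣N
    (trans (sym (m∸n+n≡m (<⇒≤ (prime⇒>1 qq)))) (cong (_+ 1) q∸1≡[x+1]p))

geometric-sum : ℤ → ℕ → ℤ
geometric-sum c zero    = 0ℤ
geometric-sum c (suc k) = c ℤ.^ k ℤ.+ geometric-sum c k

^-1≡[c-1]*geometric-sum : ∀ c k → c ℤ.^ k ℤ.- 1ℤ ≡ (c ℤ.- 1ℤ) ℤ.* geometric-sum c k
^-1≡[c-1]*geometric-sum c zero    = sym (ℤP.*-zeroʳ (c ℤ.- 1ℤ))
^-1≡[c-1]*geometric-sum c (suc k) = begin
  c ℤ.* c ℤ.^ k ℤ.- 1ℤ                                           ≡⟨ split c (c ℤ.^ k) ⟩
  (c ℤ.- 1ℤ) ℤ.* c ℤ.^ k ℤ.+ (c ℤ.^ k ℤ.- 1ℤ)                    ≡⟨ cong (λ z → (c ℤ.- 1ℤ) ℤ.* c ℤ.^ k ℤ.+ z) (^-1≡[c-1]*geometric-sum c k) ⟩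
  (c ℤ.- 1ℤ) ℤ.* c ℤ.^ k ℤ.+ (c ℤ.- 1ℤ) ℤ.* geometric-sum c k   ≡⟨ sym (ℤP.*-distribˡ-+ (c ℤ.- 1ℤ) (c ℤ.^ k) (geometric-sum c k)) ⟩
  (c ℤ.- 1ℤ) ℤ.* geometric-sum c (suc k)                          ∎
  where
  open ≡-Reasoning
  split : ∀ c d → c ℤ.* d ℤ.- 1ℤ ≡ (c ℤ.- 1ℤ) ℤ.* d ℤ.+ (d ℤ.- 1ℤ)
  split = ℤ-Solver.solve-∀

geometric-sum-≈ : ∀ {n c} → c ≈ 1ℤ [mod n ] → ∀ k → geometric-sum c k ≈ + k [mod n ]
geometric-sum-≈ c≈1 zero    = mod-refl
geometric-sum-≈ {n} {c} c≈1 (suc k) = begin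
  c ℤ.^ k ℤ.+ geometric-sum c k   ≈⟨ mod-+ (mod-^ k c≈1) (geometric-sum-≈ c≈1 k) ⟩
  1ℤ ℤ.^ k ℤ.+ + k                ≡⟨ cong (λ z → z ℤ.+ + k) (ℤP.^-zeroˡ k) ⟩
  1ℤ ℤ.+ + k                      ≡⟨ sym (ℤP.pos-+ 1 k) ⟩
  + suc k                         ∎
  where open ≈-Reasoning (mod-setoid n)

prime-factor-of-geometric-sum : ∀ {n c k} → n ≢ 0 → c ℤ.^ k ≈ 1ℤ [mod n ] → ¬ c ≈ 1ℤ [mod n ] →
  ∃ λ q → Prime q × q ∣ n × q ∣ ℤ.∣ geometric-sum c k ∣
prime-factor-of-geometric-sum {n} {c} {k} n≢0 (mod n∣c^k-1) c≉1 with coprime? n ℤ.∣ geometric-sum c k ∣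
... | no  ¬coprime = common-prime-factor n≢0 ¬coprime
... | yes coprime  = contradiction (mod (coprime-divisor coprime n∣G*[c-1])) c≉1
  where
  n∣G*[c-1] : n ∣ ℤ.∣ geometric-sum c k ∣ * ℤ.∣ c ℤ.- 1ℤ ∣
  n∣G*[c-1] = subst (n ∣_) (begin
    ℤ.∣ c ℤ.^ k ℤ.- 1ℤ ∣                             ≡⟨ cong ℤ.∣_∣ (^-1≡[c-1]*geometric-sum c k) ⟩
    ℤ.∣ (c ℤ.- 1ℤ) ℤ.* geometric-sum c k ∣           ≡⟨ ℤP.abs-* (c ℤ.- 1ℤ) (geometric-sum c k) ⟩
    ℤ.∣ c ℤ.- 1ℤ ∣ * ℤ.∣ geometric-sum c k ∣         ≡⟨ *-comm ℤ.∣ c ℤ.- 1ℤ ∣ _ ⟩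
    ℤ.∣ geometric-sum c k ∣ * ℤ.∣ c ℤ.- 1ℤ ∣         ∎) n∣c^k-1
    where open ≡-Reasoning

theorem4p5 : (a p : ℕ) → a > 0 → ¬ IsPerfectCube a → Prime p → p > a * a + 2 * a →
    (∃ λ (b : ℤ) → ((b ℤ.^ (a * p ^ 3 + 1 ∸ 1)) ≡ ℤ.1ℤ [mod (a * p ^ 3 + 1) ])
                 × ¬ ((b ℤ.^ a) ≡ ℤ.1ℤ [mod (a * p ^ 3 + 1) ])) →
    Prime (a * p ^ 3 + 1)
theorem4p5 a p _ non-cube pp bound (b , b^[N-1]≡1 , b^a≢1) =
  finish (prime-factor-of-geometric-sum {N} {c} {p ^ 3} N≢0 c^P≈1 (λ c≈1 → b^a≢1 (unmod c≈1)))
  where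
  N = a * p ^ 3 + 1
  c = b ℤ.^ a
  N≢0 : N ≢ 0
  N≢0 N≡0 = contradiction (trans (+-comm 1 (a * p ^ 3)) N≡0) λ ()
  c^P≈1 : c ℤ.^ (p ^ 3) ≈ 1ℤ [mod N ]
  c^P≈1 = mod-trans (mod-reflexive (trans (ℤP.^-*-assoc b a (p ^ 3)) (cong (b ℤ.^_) (sym (m+n∸n≡m (a * p ^ 3) 1)))))
                    (mod b^[N-1]≡1)
  finish : (∃ λ q → Prime q × q ∣ N × q ∣ ℤ.∣ geometric-sum c (p ^ 3) ∣) → Prime N
  finish (q , qq , q∣N , q∣G) =
    prime-if-factor-≡1 bound non-cube qq q∣N (prime∣q∸1 pp 3 qq (mod-divisor q∣N c^P≈1) c≉1)
    where
    c≉1 : ¬ c ≈ 1ℤ [mod q ]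
    c≉1 c≈1 = prime∤ap^k+1 a 2 pp (subst (_∣ N) (prime-dividing-power 3 qq pp q∣p³) q∣N)
      where
      q∣p³ : q ∣ p ^ 3
      q∣p³ = ≈0⇒∣ (mod-trans (mod-sym (geometric-sum-≈ c≈1 (p ^ 3))) (∣⇒≈0 q∣G))
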